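{- Let $(G,\pi)$ be a colored graph, $\mathrm{Sel}$ a cell selector, and $T=\Gamma_{\mathrm{Sel}}(G,\pi)$ the IR-tree, with each node $\nu$ colored by the quotient graph $Q(G,\mathrm{Ref}(G,\pi,\nu))$. If $l_1,l_2$ are two leaves of $T$ that are indistinguishable, then there is an automorphism of the colored rooted tree $T$ (a color-preserving automorphism of the rooted tree) mapping $l_1$ to $l_2$.
   Context: For a colored graph $(G,\pi)$ and a vertex sequence $\nu$, $\mathrm{Ref}(G,\pi,\nu)$ is the coarsest equitable coloring finer than $\pi$ in which each vertex of $\nu$ is a singleton with its own artificial color (the $i$-th vertex of $\nu$ getting the $i$-th artificial color), computed isomorphism-invariantly by color refinement. A cell selector is an isomorphism-invariant function mapping $(G,\pi)$ to $\emptyset$ if $\pi$ is discrete and otherwise to a cell of $\pi$ of size $>1$. The IR-tree $\Gamma_{\mathrm{Sel}}(G,\pi)$ has root the empty sequence, and the children of $\nu$ are $\nu.v$ for $v\in\mathrm{Sel}(G,\mathrm{Ref}(G,\pi,\nu))$. For an equitable coloring $\rho$, the quotient graph $Q(G,\rho)$ is the complete directed graph with loops whose vertices are the colors of $\rho$ and whose edge $(c_1,c_2)$ is labeled by the number of neighbors in cell $c_2$ of any vertex in cell $c_1$. Two colored graphs $(G_1,\pi_1),(G_2,\pi_2)$ are distinguishable if, w.r.t. $\rho_i=\mathrm{Ref}(G_i,\pi_i,\epsilon)$, either some color has differently sized cells in $G_1$ and $G_2$, or there are vertices $v_1\in V(G_1)$, $v_2\in V(G_2)$ of the same color and a color $c$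 such that $v_1$ and $v_2$ have different numbers of neighbors of color $c$. Two nodes (vertex sequences) $\nu_1,\nu_2$ are distinguishable if $(G,\mathrm{Ref}(G,\pi,\nu_1))$ and $(G,\mathrm{Ref}(G,\pi,\nu_2))$ are; otherwise they are indistinguishable. -}

module Defs where

open import Data.Nat using (ℕ; zero; suc; _+_; _≡ᵇ_)
open import Data.Bool using (Bool; true; false; _∧_; if_then_else_)
open import Data.Fin using (Fin; zero; suc; _≟_)
open import Data.Fin.Permutation using (Permutation′; _⟨$⟩ʳ_)
open import Data.List using (List; []; _∷_; _∷ʳ_; map)
open import Data.Maybe using (Maybe; just; nothing)
open import Data.Product using (Σ; _×_; _,_; ∃; ∃-syntax)
open import Data.Sum using (_⊎_)
open import Function.Bundles using (_⇔_)
open import Relation.Binary.PropositionalEquality using (_≡_; _≢_)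
open import Relation.Nullary using (¬_; yes; no)

record SimpleGraph (n : ℕ) : Set where
  field
    adj    : Fin n → Fin n → Bool
    sym    : ∀ x y → adj x y ≡ adj y x
    irrefl : ∀ x → adj x x ≡ false
open SimpleGraph public

Coloring : ℕ → Set
Coloring n = Fin n → ℕ

countF : ∀ {n} → (Fin n → Bool) → ℕ
countF {zero}  f = 0
countF {suc n} f = (if f zero then 1 else 0) + countF (λ i → f (suc i))

cellSize : ∀ {n} → Coloring n → ℕ → ℕ
cellSize ρ c = countF (λ w → ρ w ≡ᵇ c)

nbr : ∀ {n} → SimpleGraph n → Coloring n → Fin n → ℕ → ℕ
nbr G ρ v c = countF (λ w → adj G v w ∧ (ρ w ≡ᵇ c))

Equitable : ∀ {n} → SimpleGraph n → Coloring n → Set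
Equitable G ρ = ∀ v w c → ρ v ≡ ρ w → nbr G ρ v c ≡ nbr G ρ w c

Discrete : ∀ {n} → Coloring n → Set
Discrete ρ = ∀ v w → ρ v ≡ ρ w → v ≡ w

Finer : ∀ {n} {A B : Set} → (Fin n → A) → (Fin n → B) → Set
Finer χ σ = ∀ v w → χ v ≡ χ w → σ v ≡ σ w

-- position (index of first occurrence) of a vertex in a vertex sequence;
-- this is the index of the artificial color the vertex receives
pos : ∀ {n} → List (Fin n) → Fin n → Maybe ℕ
pos []       v = nothing
pos (x ∷ ν) v with x ≟ v
... | yes _ = just 0
... | no  _ with pos ν v
...   | just i  = just (suc i)
...   | nothing = nothing

initColoring : ∀ {n} → Coloring n → List (Fin n) → Fin n → ℕ × Maybe ℕ
initColoring π ν v = π v , pos ν v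

IsIso : ∀ {n} → Permutation′ n → SimpleGraph n → Coloring n →
        SimpleGraph n → Coloring n → Set
IsIso φ G ρ G' ρ' =
  (∀ x y → adj G' (φ ⟨$⟩ʳ x) (φ ⟨$⟩ʳ y) ≡ adj G x y) ×
  (∀ x → ρ' (φ ⟨$⟩ʳ x) ≡ ρ x)

RefFun : ℕ → Set
RefFun n = SimpleGraph n → Coloring n → List (Fin n) → Coloring n

record IsRefinement {n : ℕ} (Ref : RefFun n) : Set where
  field
    equitable  : ∀ G π ν → Equitable G (Ref G π ν)
    -- the result refines π, with the i-th vertex of ν carrying the i-th
    -- artificial color; color names are consistent, i.e. a refined
    -- color determines the original color and the artificial color
    consistent : ∀ G G' π π' ν ν' v w → Ref G π ν v ≡ Ref G' π' ν' w →
                 (π v ≡ π' w) × (pos ν v ≡ pos ν' w)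
    coarsest   : ∀ G π ν (χ : Coloring n) → Equitable G χ →
                 Finer χ (initColoring π ν) → Finer χ (Ref G π ν)
    invariant  : ∀ (φ : Permutation′ n) G π G' π' ν → IsIso φ G π G' π' →
                 ∀ v → Ref G' π' (map (φ ⟨$⟩ʳ_) ν) (φ ⟨$⟩ʳ v) ≡ Ref G π ν v

SelFun : ℕ → Set
SelFun n = SimpleGraph n → Coloring n → Maybe ℕ

record IsCellSelector {n : ℕ} (Sel : SelFun n) : Set where
  field
    discrete→nothing : ∀ G ρ → Discrete ρ → Sel G ρ ≡ nothing
    nothing→discrete : ∀ G ρ → Sel G ρ ≡ nothing → Discrete ρ
    just→nontrivial  : ∀ G ρ c → Sel G ρ ≡ just c →
                       Σ (Fin n) λ v → Σ (Fin n) λ w →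
                         (v ≢ w) × (ρ v ≡ c) × (ρ w ≡ c)
    invariant        : ∀ (φ : Permutation′ n) G ρ G' ρ' →
                       IsIso φ G ρ G' ρ' → Sel G' ρ' ≡ Sel G ρ

-- Quotient graphs: equality of Q(G,ρ₁) and Q(G',ρ₂) as labelled
-- complete directed graphs with loops on the colors.

HasColor : ∀ {n} → Coloring n → ℕ → Set
HasColor ρ c = ∃[ v ] ρ v ≡ c

SameQuotient : ∀ {n} → SimpleGraph n → Coloring n →
               SimpleGraph n → Coloring n → Set
SameQuotient G ρ₁ G' ρ₂ =
  (∀ c → HasColor ρ₁ c ⇔ HasColor ρ₂ c) ×
  -- same edge labels: the label of (c₁,c₂) is the number of neighbours of
  -- color c₂ of any vertex of color c₁
  (∀ c₁ c₂ v₁ v₂ → ρ₁ v₁ ≡ c₁ → ρ₂ v₂ ≡ c₁ → HasColor ρ₁ c₂ →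
     nbr G ρ₁ v₁ c₂ ≡ nbr G' ρ₂ v₂ c₂)

DistinguishableCG : ∀ {n} → RefFun n → SimpleGraph n → Coloring n →
                    SimpleGraph n → Coloring n → Set
DistinguishableCG Ref G₁ π₁ G₂ π₂ =
  (∃[ c ] cellSize ρ₁ c ≢ cellSize ρ₂ c) ⊎
  (∃[ v₁ ] ∃[ v₂ ] ∃[ c ] (ρ₁ v₁ ≡ ρ₂ v₂) × (nbr G₁ ρ₁ v₁ c ≢ nbr G₂ ρ₂ v₂ c))
  where
    ρ₁ = Ref G₁ π₁ []
    ρ₂ = Ref G₂ π₂ []

module IRTree {n : ℕ} (Ref : RefFun n) (Sel : SelFun n)
              (G : SimpleGraph n) (π : Coloring n) where

  col : List (Fin n) → Coloring n
  col ν = Ref G π ν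

  data IsNode : List (Fin n) → Set where
    root  : IsNode []
    child : ∀ {ν c v} → IsNode ν → Sel G (col ν) ≡ just c →
            col ν v ≡ c → IsNode (ν ∷ʳ v)

  IsLeaf : List (Fin n) → Set
  IsLeaf ν = IsNode ν × (Sel G (col ν) ≡ nothing)

  ChildOf : List (Fin n) → List (Fin n) → Set
  ChildOf μ ν = IsNode μ × IsNode ν × ∃[ v ] μ ≡ ν ∷ʳ v

  NodesDistinguishable : List (Fin n) → List (Fin n) → Set
  NodesDistinguishable ν₁ ν₂ = DistinguishableCG Ref G (col ν₁) G (col ν₂)

  record ColoredTreeAut (f : List (Fin n) → List (Fin n)) : Set where
    field
      nodes      : ∀ {ν} → IsNode ν → IsNode (f ν)
      injective  : ∀ {ν μ} → IsNode ν → IsNode μ → f ν ≡ f μ → ν ≡ μ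
      surjective : ∀ {μ} → IsNode μ → ∃[ ν ] IsNode ν × f ν ≡ μ
      root↦root  : f [] ≡ []
      edges      : ∀ {ν μ} → IsNode ν → IsNode μ →
                   ChildOf μ ν ⇔ ChildOf (f μ) (f ν)
      colors     : ∀ {ν} → IsNode ν →
                   SameQuotient G (col ν) G (col (f ν))

{-# OPTIONS --safe #-}
-- The refined coloring at a leaf is discrete, so for indistinguishable leaves l₁, l₂ every color
-- occurs exactly once in both refinements, and matching equally colored vertices is a permutation
-- φ. It preserves adjacency, since in a discrete coloring x has one or no neighbour in the cell of
-- y according as x ~ y. A refined color determines the colors it refines, in particular the
-- original color and the artificial color (the position in the leaf), so φ is an automorphism of
-- (G, π) with φ(l₁) = l₂. By isomorphism invariance of refinement and cell selection, any
-- automorphism of (G, π) acts on the IR-tree by ν ↦ φ(ν), preserving the child relation and the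
-- quotient graphs.
module Submission where

open import Data.Nat using (ℕ)
open import Data.Fin using (Fin)
open import Data.List using (List)
open import Data.Product using (Σ; _×_)
open import Relation.Binary.PropositionalEquality using (_≡_)
open import Relation.Nullary using (¬_)

open import Defs hiding (sym)
open import Data.Bool using (Bool; true; false; _∧_; if_then_else_)
open import Data.Bool.Properties using (¬-not; T-≡; ∧-identityʳ)
open import Data.Empty using (⊥-elim)
open import Data.Fin using (zero; suc; _≟_; punchIn)
open import Data.Fin.Permutation
  using (Permutation′; _⟨$⟩ʳ_; _⟨$⟩ˡ_; inverseˡ; inverseʳ; permutation; flip)
open import Data.Fin.Properties using (punchInᵢ≢i)
open import Data.List using ([]; _∷_; _++_; _∷ʳ_; map; head; drop)
import Data.List.Properties as List
open import Data.Maybe using (just; nothing)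
import Data.Maybe as Maybe
import Data.Maybe.Properties as Maybe
open import Data.Nat using (zero; suc; _+_; _≡ᵇ_)
open import Data.Nat.Properties as ℕ using (+-0-commutativeMonoid; suc-injective; ≡ᵇ⇒≡; ≡⇒≡ᵇ)
open import Algebra.Properties.CommutativeMonoid.Sum +-0-commutativeMonoid
  using (sum; sum-remove; sum-cong-≗; sum-permute)
open import Data.Product using (_,_; proj₁; proj₂; ∃-syntax)
open import Data.Sum using (inj₁; inj₂)
open import Data.Unit using (⊤; tt)
open import Data.Vec.Functional using (removeAt)
open import Function using (_∘_; _⇔_; mk⇔; Equivalence)
open import Function.Definitions using (Injective)
open import Relation.Binary.PropositionalEquality
  using (_≢_; _≗_; refl; sym; trans; cong; cong₂; subst; module ≡-Reasoning)
open import Relation.Nullary using (Dec; yes; no)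
open import Relation.Nullary.Decidable using (decidable-stable)

𝟙 : Bool → ℕ
𝟙 b = if b then 1 else 0

𝟙-injective : ∀ {a b} → 𝟙 a ≡ 𝟙 b → a ≡ b
𝟙-injective {true}  {true}  _ = refl
𝟙-injective {false} {false} _ = refl

countF≡sum : ∀ {n} (f : Fin n → Bool) → countF f ≡ sum (𝟙 ∘ f)
countF≡sum {zero}  f = refl
countF≡sum {suc n} f = cong (𝟙 (f zero) +_) (countF≡sum (f ∘ suc))

countF-cong : ∀ {n} {f g : Fin n → Bool} → f ≗ g → countF f ≡ countF g
countF-cong {f = f} {g} f≗g = begin
  countF f      ≡⟨ countF≡sum f ⟩
  sum (𝟙 ∘ f)   ≡⟨ sum-cong-≗ (cong 𝟙 ∘ f≗g) ⟩
  sum (𝟙 ∘ g)   ≡⟨ countF≡sum g ⟨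
  countF g      ∎
  where open ≡-Reasoning

countF-permute : ∀ {n} (φ : Permutation′ n) (f : Fin n → Bool) →
                 countF (f ∘ (φ ⟨$⟩ʳ_)) ≡ countF f
countF-permute φ f = begin
  countF (f ∘ (φ ⟨$⟩ʳ_))   ≡⟨ countF≡sum (f ∘ (φ ⟨$⟩ʳ_)) ⟩
  sum (𝟙 ∘ f ∘ (φ ⟨$⟩ʳ_))  ≡⟨ sum-permute (𝟙 ∘ f) φ ⟨
  sum (𝟙 ∘ f)              ≡⟨ countF≡sum f ⟨
  countF f                 ∎
  where open ≡-Reasoning

countF-remove : ∀ {n} (f : Fin (suc n) → Bool) (u : Fin (suc n)) →
                countF f ≡ 𝟙 (f u) + countF (removeAt f u)
countF-remove f u = begin
  countF f                           ≡⟨ countF≡sum f ⟩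
  sum (𝟙 ∘ f)                        ≡⟨ sum-remove {i = u} (𝟙 ∘ f) ⟩
  𝟙 (f u) + sum (𝟙 ∘ removeAt f u)   ≡⟨ cong (𝟙 (f u) +_) (countF≡sum (removeAt f u)) ⟨
  𝟙 (f u) + countF (removeAt f u)    ∎
  where open ≡-Reasoning

countF-false : ∀ {n} (f : Fin n → Bool) → (∀ w → f w ≡ false) → countF f ≡ 0
countF-false {zero}  f _ = refl
countF-false {suc n} f f≡false rewrite f≡false zero = countF-false (f ∘ suc) (f≡false ∘ suc)

true⇒countF≢0 : ∀ {n} (f : Fin n → Bool) (u : Fin n) → f u ≡ true → countF f ≢ 0
true⇒countF≢0 {suc n} f u fu≡true rewrite countF-remove f u | fu≡true = λ ()

countF≢0⇒∃ : ∀ {n} (f : Fin n → Bool) → countF f ≢ 0 → ∃[ w ] f w ≡ true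
countF≢0⇒∃ {zero}  f count≢0 = ⊥-elim (count≢0 refl)
countF≢0⇒∃ {suc n} f count≢0 with f zero in fzero≡
... | true  = zero , fzero≡
... | false with countF≢0⇒∃ (f ∘ suc) count≢0
...   | w , fw≡true = suc w , fw≡true

countF-unique : ∀ {n} (f : Fin n → Bool) (u : Fin n) →
                (∀ w → f w ≡ true → w ≡ u) → countF f ≡ 𝟙 (f u)
countF-unique {suc n} f u unique = begin
  countF f                          ≡⟨ countF-remove f u ⟩
  𝟙 (f u) + countF (removeAt f u)   ≡⟨ cong (𝟙 (f u) +_) (countF-false (removeAt f u) off-u) ⟩
  𝟙 (f u) + 0                       ≡⟨ ℕ.+-identityʳ (𝟙 (f u)) ⟩
  𝟙 (f u)                           ∎
  where
  open ≡-Reasoning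
  off-u : ∀ i → f (punchIn u i) ≡ false
  off-u i = ¬-not (punchInᵢ≢i u i ∘ unique (punchIn u i))

map-∷ʳ : ∀ {A B : Set} (f : A → B) xs x → map f (xs ∷ʳ x) ≡ map f xs ∷ʳ f x
map-∷ʳ f xs x = List.map-++ f xs (x ∷ [])

⟨$⟩ʳ-injective : ∀ {n} (φ : Permutation′ n) {a b} → φ ⟨$⟩ʳ a ≡ φ ⟨$⟩ʳ b → a ≡ b
⟨$⟩ʳ-injective φ eq = trans (sym (inverseˡ φ)) (trans (cong (φ ⟨$⟩ˡ_) eq) (inverseˡ φ))

pos-here : ∀ {n} (x : Fin n) ν → pos (x ∷ ν) x ≡ just 0
pos-here x ν with x ≟ x
... | yes _   = refl
... | no x≢x = ⊥-elim (x≢x refl)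

pos-there : ∀ {n} (x : Fin n) ν v → x ≢ v → pos (x ∷ ν) v ≡ Maybe.map suc (pos ν v)
pos-there x ν v x≢v with x ≟ v
... | yes x≡v = ⊥-elim (x≢v x≡v)
... | no _ with pos ν v
...   | just i  = refl
...   | nothing = refl

map-suc≢just0 : ∀ m → Maybe.map suc m ≢ just 0
map-suc≢just0 (just _) ()
map-suc≢just0 nothing  ()

pos-∷≡nothing : ∀ {n} (x : Fin n) ν v → pos (x ∷ ν) v ≡ nothing → x ≢ v × pos ν v ≡ nothing
pos-∷≡nothing x ν v eq = x≢v , map-suc≡nothing (pos ν v) (trans (sym (pos-there x ν v x≢v)) eq)
  where
  x≢v : x ≢ v
  x≢v refl with () ← trans (sym (pos-here x ν)) eq
  map-suc≡nothing : ∀ m → Maybe.map suc m ≡ nothing → m ≡ nothing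
  map-suc≡nothing nothing _ = refl

pos-++ : ∀ {n} (ν μ : List (Fin n)) v → pos ν v ≡ nothing → pos μ v ≡ nothing →
         pos (ν ++ μ) v ≡ nothing
pos-++ []      μ v _  μv = μv
pos-++ (x ∷ ν) μ v xνv μv = begin
  pos (x ∷ ν ++ μ) v              ≡⟨ pos-there x (ν ++ μ) v x≢v ⟩
  Maybe.map suc (pos (ν ++ μ) v)  ≡⟨ cong (Maybe.map suc) (pos-++ ν μ v νv μv) ⟩
  nothing                         ∎
  where
  open ≡-Reasoning
  x≢v = proj₁ (pos-∷≡nothing x ν v xνv)
  νv  = proj₂ (pos-∷≡nothing x ν v xνv)

pos-sound : ∀ {n} (ν : List (Fin n)) v {i} → pos ν v ≡ just i → head (drop i ν) ≡ just v
pos-sound (x ∷ ν) v eq with x ≟ v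
pos-sound (x ∷ ν) v refl | yes refl = refl
... | no _ with pos ν v in νv
pos-sound (x ∷ ν) v refl | no _ | just i = pos-sound ν v νv

pos-injective : ∀ {n} (ν : List (Fin n)) {u v i} → pos ν u ≡ just i → pos ν v ≡ just i → u ≡ v
pos-injective ν {u} {v} νu νv =
  Maybe.just-injective (trans (sym (pos-sound ν u νu)) (pos-sound ν v νv))

pos-map : ∀ {n} {f : Fin n → Fin n} → Injective _≡_ _≡_ f →
          ∀ ν v → pos (map f ν) (f v) ≡ pos ν v
pos-map f-inj []      v = refl
pos-map {f = f} f-inj (x ∷ ν) v = by-cases (x ≟ v)
  where
  open ≡-Reasoning
  by-cases : Dec (x ≡ v) → pos (map f (x ∷ ν)) (f v) ≡ pos (x ∷ ν) v
  by-cases (yes refl) = trans (pos-here (f x) (map f ν)) (sym (pos-here x ν))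
  by-cases (no x≢v)   = begin
    pos (f x ∷ map f ν) (f v)           ≡⟨ pos-there (f x) (map f ν) (f v) (x≢v ∘ f-inj) ⟩
    Maybe.map suc (pos (map f ν) (f v)) ≡⟨ cong (Maybe.map suc) (pos-map f-inj ν v) ⟩
    Maybe.map suc (pos ν v)             ≡⟨ pos-there x ν v x≢v ⟨
    pos (x ∷ ν) v                       ∎

Distinct : ∀ {n} → List (Fin n) → Set
Distinct []      = ⊤
Distinct (x ∷ ν) = pos ν x ≡ nothing × Distinct ν

Distinct-∷ʳ : ∀ {n} (ν : List (Fin n)) v → Distinct ν → pos ν v ≡ nothing → Distinct (ν ∷ʳ v)
Distinct-∷ʳ []      v _           _   = refl , tt
Distinct-∷ʳ (x ∷ ν) v (νx , dν) xνv =
  pos-++ ν (v ∷ []) x νx (pos-there v [] x (x≢v ∘ sym)) , Distinct-∷ʳ ν v dν νv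
  where
  x≢v = proj₁ (pos-∷≡nothing x ν v xνv)
  νv  = proj₂ (pos-∷≡nothing x ν v xνv)

Distinct-map : ∀ {n} {f : Fin n → Fin n} → Injective _≡_ _≡_ f →
               ∀ ν → Distinct ν → Distinct (map f ν)
Distinct-map f-inj []      _         = tt
Distinct-map f-inj (x ∷ ν) (νx , dν) = trans (pos-map f-inj ν x) νx , Distinct-map f-inj ν dν

Distinct-pos-ext : ∀ {n} (ν μ : List (Fin n)) → Distinct ν → Distinct μ →
                            (∀ u → pos ν u ≡ pos μ u) → ν ≡ μ
Distinct-pos-ext []      []      _ _ _ = refl
Distinct-pos-ext []      (y ∷ μ) _ _ eq with () ← trans (eq y) (pos-here y μ)
Distinct-pos-ext (x ∷ ν) []      _ _ eq with () ← trans (sym (eq x)) (pos-here x ν)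
Distinct-pos-ext (x ∷ ν) (y ∷ μ) (νx , dν) (μy , dμ) eq with y ≟ x
... | no y≢x = ⊥-elim (map-suc≢just0 (pos μ x)
                   (trans (sym (pos-there y μ x y≢x)) (trans (sym (eq x)) (pos-here x ν))))
... | yes refl = cong (x ∷_) (Distinct-pos-ext ν μ dν dμ tails)
  where
  tails : ∀ u → pos ν u ≡ pos μ u
  tails u with x ≟ u
  ... | yes refl = trans νx (sym μy)
  ... | no x≢u   = Maybe.map-injective suc-injective
                     (trans (sym (pos-there x ν u x≢u)) (trans (eq u) (pos-there x μ u x≢u)))

pos-preserving⇒map≡ : ∀ {n} (φ : Permutation′ n) ν μ → Distinct ν → Distinct μ →
                      (∀ x → pos μ (φ ⟨$⟩ʳ x) ≡ pos ν x) → map (φ ⟨$⟩ʳ_) ν ≡ μ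
pos-preserving⇒map≡ φ ν μ dν dμ pos≡ =
  Distinct-pos-ext (map (φ ⟨$⟩ʳ_) ν) μ (Distinct-map (⟨$⟩ʳ-injective φ) ν dν) dμ same-pos
  where
  same-pos : ∀ u → pos (map (φ ⟨$⟩ʳ_) ν) u ≡ pos μ u
  same-pos u = subst (λ u → pos (map (φ ⟨$⟩ʳ_) ν) u ≡ pos μ u) (inverseʳ φ)
                     (trans (pos-map (⟨$⟩ʳ-injective φ) ν (φ ⟨$⟩ˡ u)) (sym (pos≡ (φ ⟨$⟩ˡ u))))

≡ᵇ-true⇒≡ : ∀ {m k} → (m ≡ᵇ k) ≡ true → m ≡ k
≡ᵇ-true⇒≡ {m} {k} eq = ≡ᵇ⇒≡ m k (Equivalence.from T-≡ eq)

≡ᵇ-refl : ∀ m → (m ≡ᵇ m) ≡ true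
≡ᵇ-refl m = Equivalence.to T-≡ (≡⇒≡ᵇ m m refl)

∧-true⇒ʳ : ∀ a {b} → (a ∧ b) ≡ true → b ≡ true
∧-true⇒ʳ true eq = eq

IsIso-flip : ∀ {n} (φ : Permutation′ n) G ρ G' ρ' → IsIso φ G ρ G' ρ' → IsIso (flip φ) G' ρ' G ρ
IsIso-flip φ G ρ G' ρ' (adj≡ , col≡) =
  (λ x y → trans (sym (adj≡ (φ ⟨$⟩ˡ x) (φ ⟨$⟩ˡ y))) (cong₂ (adj G') (inverseʳ φ) (inverseʳ φ))) ,
  (λ x → trans (sym (col≡ (φ ⟨$⟩ˡ x))) (cong ρ' (inverseʳ φ)))

nbr-iso : ∀ {n} (φ : Permutation′ n) G ρ G' ρ' → IsIso φ G ρ G' ρ' →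
          ∀ v c → nbr G' ρ' (φ ⟨$⟩ʳ v) c ≡ nbr G ρ v c
nbr-iso φ G ρ G' ρ' (adj≡ , col≡) v c = begin
  nbr G' ρ' (φ ⟨$⟩ʳ v) c                                               ≡⟨ countF-permute φ _ ⟨
  countF (λ w → adj G' (φ ⟨$⟩ʳ v) (φ ⟨$⟩ʳ w) ∧ (ρ' (φ ⟨$⟩ʳ w) ≡ᵇ c))  ≡⟨ countF-cong same ⟩
  nbr G ρ v c                                                          ∎
  where
  open ≡-Reasoning
  same : ∀ w → (adj G' (φ ⟨$⟩ʳ v) (φ ⟨$⟩ʳ w) ∧ (ρ' (φ ⟨$⟩ʳ w) ≡ᵇ c)) ≡ (adj G v w ∧ (ρ w ≡ᵇ c))
  same w = cong₂ _∧_ (adj≡ v w) (cong (_≡ᵇ c) (col≡ w))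

IsIso⇒SameQuotient : ∀ {n} (φ : Permutation′ n) G ρ G' ρ' → IsIso φ G ρ G' ρ' →
                     Equitable G' ρ' → SameQuotient G ρ G' ρ'
IsIso⇒SameQuotient φ G ρ G' ρ' iso@(_ , col≡) equitable' = colors , labels
  where
  col⁻¹≡ : ∀ v → ρ (φ ⟨$⟩ˡ v) ≡ ρ' v
  col⁻¹≡ = proj₂ (IsIso-flip φ G ρ G' ρ' iso)
  colors : ∀ c → HasColor ρ c ⇔ HasColor ρ' c
  colors c = mk⇔ (λ (v , ρv≡c) → φ ⟨$⟩ʳ v , trans (col≡ v) ρv≡c)
                 (λ (v , ρ'v≡c) → φ ⟨$⟩ˡ v , trans (col⁻¹≡ v) ρ'v≡c)
  labels : ∀ c₁ c₂ v₁ v₂ → ρ v₁ ≡ c₁ → ρ' v₂ ≡ c₁ → HasColor ρ c₂ →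
           nbr G ρ v₁ c₂ ≡ nbr G' ρ' v₂ c₂
  labels c₁ c₂ v₁ v₂ ρv₁≡c₁ ρ'v₂≡c₁ _ =
    trans (sym (nbr-iso φ G ρ G' ρ' iso v₁ c₂))
          (equitable' (φ ⟨$⟩ʳ v₁) v₂ c₂ (trans (col≡ v₁) (trans ρv₁≡c₁ (sym ρ'v₂≡c₁))))

nbr-discrete : ∀ {n} (G : SimpleGraph n) {ρ} → Discrete ρ → ∀ x y → nbr G ρ x (ρ y) ≡ 𝟙 (adj G x y)
nbr-discrete G {ρ} discrete x y = begin
  nbr G ρ x (ρ y)                   ≡⟨ countF-unique _ y only-y ⟩
  𝟙 (adj G x y ∧ (ρ y ≡ᵇ ρ y))      ≡⟨ cong (𝟙 ∘ (adj G x y ∧_)) (≡ᵇ-refl (ρ y)) ⟩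
  𝟙 (adj G x y ∧ true)              ≡⟨ cong 𝟙 (∧-identityʳ (adj G x y)) ⟩
  𝟙 (adj G x y)                     ∎
  where
  open ≡-Reasoning
  only-y : ∀ w → (adj G x w ∧ (ρ w ≡ᵇ ρ y)) ≡ true → w ≡ y
  only-y w eq = discrete w y (≡ᵇ-true⇒≡ (∧-true⇒ʳ (adj G x w) eq))

sameCellSizes⇒color : ∀ {n} (ρ ρ' : Coloring n) → (∀ c → cellSize ρ c ≡ cellSize ρ' c) →
                      ∀ v → ∃[ w ] ρ' w ≡ ρ v
sameCellSizes⇒color ρ ρ' sizes v with countF≢0⇒∃ (λ w → ρ' w ≡ᵇ ρ v) cell'≢0
  where
  cell'≢0 : cellSize ρ' (ρ v) ≢ 0
  cell'≢0 = true⇒countF≢0 (λ w → ρ w ≡ᵇ ρ v) v (≡ᵇ-refl (ρ v)) ∘ trans (sizes (ρ v))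
... | w , ρ'w≡ᵇρv = w , ≡ᵇ-true⇒≡ ρ'w≡ᵇρv

discrete-indistinguishable⇒iso :
  ∀ {n} (G₁ G₂ : SimpleGraph n) {ρ₁ ρ₂ : Coloring n} → Discrete ρ₁ → Discrete ρ₂ →
  (∀ c → cellSize ρ₁ c ≡ cellSize ρ₂ c) →
  (∀ v₁ v₂ c → ρ₁ v₁ ≡ ρ₂ v₂ → nbr G₁ ρ₁ v₁ c ≡ nbr G₂ ρ₂ v₂ c) →
  Σ (Permutation′ n) λ φ → IsIso φ G₁ ρ₁ G₂ ρ₂
discrete-indistinguishable⇒iso G₁ G₂ {ρ₁} {ρ₂} discrete₁ discrete₂ sizes nbrs =
  φ , adj-preserved , ψ-color
  where
  ψ χ : Fin _ → Fin _
  ψ = proj₁ ∘ sameCellSizes⇒color ρ₁ ρ₂ sizes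
  χ = proj₁ ∘ sameCellSizes⇒color ρ₂ ρ₁ (sym ∘ sizes)

  ψ-color : ∀ v → ρ₂ (ψ v) ≡ ρ₁ v
  ψ-color = proj₂ ∘ sameCellSizes⇒color ρ₁ ρ₂ sizes
  χ-color : ∀ v → ρ₁ (χ v) ≡ ρ₂ v
  χ-color = proj₂ ∘ sameCellSizes⇒color ρ₂ ρ₁ (sym ∘ sizes)

  φ : Permutation′ _
  φ = permutation ψ χ (λ v → discrete₂ _ _ (trans (ψ-color (χ v)) (χ-color v)))
                      (λ v → discrete₁ _ _ (trans (χ-color (ψ v)) (ψ-color v)))

  adj-preserved : ∀ x y → adj G₂ (ψ x) (ψ y) ≡ adj G₁ x y
  adj-preserved x y = 𝟙-injective (begin
    𝟙 (adj G₂ (ψ x) (ψ y))      ≡⟨ nbr-discrete G₂ discrete₂ (ψ x) (ψ y) ⟨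
    nbr G₂ ρ₂ (ψ x) (ρ₂ (ψ y))  ≡⟨ cong (nbr G₂ ρ₂ (ψ x)) (ψ-color y) ⟩
    nbr G₂ ρ₂ (ψ x) (ρ₁ y)      ≡⟨ nbrs x (ψ x) (ρ₁ y) (sym (ψ-color x)) ⟨
    nbr G₁ ρ₁ x (ρ₁ y)          ≡⟨ nbr-discrete G₁ discrete₁ x y ⟩
    𝟙 (adj G₁ x y)              ∎)
    where open ≡-Reasoning

module _ {n} (Ref : RefFun n) (G₁ : SimpleGraph n) (π₁ : Coloring n)
         (G₂ : SimpleGraph n) (π₂ : Coloring n)
         (indistinguishable : ¬ DistinguishableCG Ref G₁ π₁ G₂ π₂) where

  ¬Distinguishable⇒cellSize≡ : ∀ c → cellSize (Ref G₁ π₁ []) c ≡ cellSize (Ref G₂ π₂ []) c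
  ¬Distinguishable⇒cellSize≡ c = decidable-stable (_ ℕ.≟ _) (λ ≢ → indistinguishable (inj₁ (c , ≢)))

  ¬Distinguishable⇒nbr≡ : ∀ v₁ v₂ c → Ref G₁ π₁ [] v₁ ≡ Ref G₂ π₂ [] v₂ →
                          nbr G₁ (Ref G₁ π₁ []) v₁ c ≡ nbr G₂ (Ref G₂ π₂ []) v₂ c
  ¬Distinguishable⇒nbr≡ v₁ v₂ c same-color =
    decidable-stable (_ ℕ.≟ _) (λ ≢ → indistinguishable (inj₂ (v₁ , v₂ , c , same-color , ≢)))

Ref-discrete : ∀ {n} {Ref : RefFun n} → IsRefinement Ref →
               ∀ G σ ν → Discrete σ → Discrete (Ref G σ ν)
Ref-discrete isRef G σ ν discrete v w same =
  discrete v w (proj₁ (IsRefinement.consistent isRef G G σ σ ν ν v w same))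

module _ {n} {Ref : RefFun n} (isRef : IsRefinement Ref)
         {Sel : SelFun n} (isSel : IsCellSelector Sel) (G : SimpleGraph n) (π : Coloring n) where

  open IRTree Ref Sel G π
  private
    module R = IsRefinement isRef
    module S = IsCellSelector isSel

  -- The vertex added at a child lies in a cell of size > 1, while each vertex of ν is alone in
  -- its cell, having its own artificial color.
  node-distinct : ∀ {ν} → IsNode ν → Distinct ν
  node-distinct root = tt
  node-distinct (child {ν} {c} {v} node sel νv≡c) = Distinct-∷ʳ ν v (node-distinct node) fresh
    where
    fresh : pos ν v ≡ nothing
    fresh with pos ν v in νv | S.just→nontrivial G (col ν) c sel
    ... | nothing | _ = refl
    ... | just i  | v′ , w′ , v′≢w′ , v′≡c , w′≡c =
      ⊥-elim (v′≢w′ (pos-injective ν (pos-in-cell v′ v′≡c) (pos-in-cell w′ w′≡c)))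
      where
      pos-in-cell : ∀ u → col ν u ≡ c → pos ν u ≡ just i
      pos-in-cell u u≡c = trans (proj₂ (R.consistent G G π π ν ν u v (trans u≡c (sym νv≡c)))) νv

  module _ (φ : Permutation′ n) (aut : IsIso φ G π G π) where

    col-map : ∀ ν x → col (map (φ ⟨$⟩ʳ_) ν) (φ ⟨$⟩ʳ x) ≡ col ν x
    col-map ν = R.invariant φ G π G π ν aut

    map-node : ∀ {ν} → IsNode ν → IsNode (map (φ ⟨$⟩ʳ_) ν)
    map-node root = root
    map-node (child {ν} {c} {v} node sel νv≡c) =
      subst IsNode (sym (map-∷ʳ (φ ⟨$⟩ʳ_) ν v))
        (child (map-node node) (trans (S.invariant φ G (col ν) G _ (proj₁ aut , col-map ν)) sel)
                               (trans (col-map ν v) νv≡c))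

  Aut⇒ColoredTreeAut : (φ : Permutation′ n) → IsIso φ G π G π → ColoredTreeAut (map (φ ⟨$⟩ʳ_))
  Aut⇒ColoredTreeAut φ aut = record
    { nodes      = map-node φ aut
    ; injective  = λ _ _ → map-φ-injective
    ; surjective = λ {μ} μ-node →
                     map (φ ⟨$⟩ˡ_) μ ,
                     map-node (flip φ) (IsIso-flip φ G π G π aut) μ-node ,
                     map-φ-φ⁻¹ μ
    ; root↦root  = refl
    ; edges      = λ ν-node μ-node → mk⇔ (map-child ν-node μ-node) (unmap-child ν-node μ-node)
    ; colors     = λ {ν} _ → IsIso⇒SameQuotient φ G (col ν) G (col (φ⃗ ν))
                               (proj₁ aut , col-map φ aut ν) (R.equitable G π (φ⃗ ν))
    }
    where
    open ≡-Reasoning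
    φ⃗ : List (Fin n) → List (Fin n)
    φ⃗ = map (φ ⟨$⟩ʳ_)

    map-φ-injective : ∀ {ν μ} → φ⃗ ν ≡ φ⃗ μ → ν ≡ μ
    map-φ-injective = List.map-injective (⟨$⟩ʳ-injective φ)

    map-φ-φ⁻¹ : ∀ μ → φ⃗ (map (φ ⟨$⟩ˡ_) μ) ≡ μ
    map-φ-φ⁻¹ μ = begin
      φ⃗ (map (φ ⟨$⟩ˡ_) μ)              ≡⟨ List.map-∘ μ ⟨
      map (λ v → φ ⟨$⟩ʳ (φ ⟨$⟩ˡ v)) μ  ≡⟨ List.map-cong (λ _ → inverseʳ φ) μ ⟩
      map (λ v → v) μ                  ≡⟨ List.map-id μ ⟩
      μ                                ∎

    map-child : ∀ {ν μ} → IsNode ν → IsNode μ → ChildOf μ ν → ChildOf (φ⃗ μ) (φ⃗ ν)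
    map-child {ν} _ _ (μ-node , ν-node , v , refl) =
      map-node φ aut μ-node , map-node φ aut ν-node , φ ⟨$⟩ʳ v , map-∷ʳ (φ ⟨$⟩ʳ_) ν v

    unmap-child : ∀ {ν μ} → IsNode ν → IsNode μ → ChildOf (φ⃗ μ) (φ⃗ ν) → ChildOf μ ν
    unmap-child {ν} {μ} ν-node μ-node (_ , _ , w , eq) =
      μ-node , ν-node , φ ⟨$⟩ˡ w , map-φ-injective (begin
        φ⃗ μ                             ≡⟨ eq ⟩
        φ⃗ ν ∷ʳ w                        ≡⟨ cong (φ⃗ ν ∷ʳ_) (inverseʳ φ) ⟨
        φ⃗ ν ∷ʳ (φ ⟨$⟩ʳ (φ ⟨$⟩ˡ w))      ≡⟨ map-∷ʳ (φ ⟨$⟩ʳ_) ν (φ ⟨$⟩ˡ w) ⟨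
        φ⃗ (ν ∷ʳ (φ ⟨$⟩ˡ w))             ∎)

lemma4 : ∀ {n} (Ref : RefFun n) → IsRefinement Ref →
    (Sel : SelFun n) → IsCellSelector Sel →
    (G : SimpleGraph n) (π : Coloring n) (l₁ l₂ : List (Fin n)) →
    IRTree.IsLeaf Ref Sel G π l₁ → IRTree.IsLeaf Ref Sel G π l₂ →
    ¬ IRTree.NodesDistinguishable Ref Sel G π l₁ l₂ →
    Σ (List (Fin n) → List (Fin n)) λ f →
    IRTree.ColoredTreeAut Ref Sel G π f × (f l₁ ≡ l₂)
lemma4 Ref isRef Sel isSel G π l₁ l₂ (leaf₁ , sel₁) (leaf₂ , sel₂) indistinguishable =
  map (φ ⟨$⟩ʳ_) , Aut⇒ColoredTreeAut isRef isSel G π φ aut , map-l₁≡l₂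
  where
  open IRTree Ref Sel G π
  open IsRefinement isRef using (consistent)

  leaf-discrete : ∀ l → Sel G (col l) ≡ nothing → Discrete (Ref G (col l) [])
  leaf-discrete l sel = Ref-discrete isRef G _ [] (IsCellSelector.nothing→discrete isSel G _ sel)

  leaf-iso : Σ (Permutation′ _) λ φ → IsIso φ G (Ref G (col l₁) []) G (Ref G (col l₂) [])
  leaf-iso = discrete-indistinguishable⇒iso G G (leaf-discrete l₁ sel₁) (leaf-discrete l₂ sel₂)
               (¬Distinguishable⇒cellSize≡ Ref G (col l₁) G (col l₂) indistinguishable)
               (¬Distinguishable⇒nbr≡ Ref G (col l₁) G (col l₂) indistinguishable)

  φ : Permutation′ _
  φ = proj₁ leaf-iso

  col-matched : ∀ x → col l₂ (φ ⟨$⟩ʳ x) ≡ col l₁ x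
  col-matched x = proj₁ (consistent G G (col l₂) (col l₁) [] [] _ x (proj₂ (proj₂ leaf-iso) x))

  aut : IsIso φ G π G π
  aut = proj₁ (proj₂ leaf-iso) , λ x → proj₁ (consistent G G π π l₂ l₁ _ x (col-matched x))

  map-l₁≡l₂ : map (φ ⟨$⟩ʳ_) l₁ ≡ l₂
  map-l₁≡l₂ = pos-preserving⇒map≡ φ l₁ l₂
                (node-distinct isRef isSel G π leaf₁) (node-distinct isRef isSel G π leaf₂)
                (λ x → proj₂ (consistent G G π π l₂ l₁ _ x (col-matched x)))
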